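{- Let $k$ be odd and $n$ even with $3\le k\le n-1$. Then the Harary graph $H_{k,n}$ satisfies \[\operatorname{gon}(H_{k,n})\le\frac{(k-1)k(k+1)}{6}.\]
   Context: For $n$ even and $k$ odd with $3\le k\le n-1$, the Harary graph $H_{k,n}$ is the circulant graph $\mathrm{Ci}_n(\{1,2,\ldots,(k-1)/2,\ n/2\})$: vertices $v_1,\ldots,v_n$, with $v_i$ adjacent to $v_m$ iff $|i-m|\bmod n\in\{1,\ldots,(k-1)/2,n/2\}$. For a connected loopless multigraph $G$: a divisor is a function $D:V(G)\to\mathbb{Z}$; effective if all values are $\ge0$; degree $\sum_vD(v)$. Firing a vertex $v$ moves one chip from $v$ along each incident edge; divisors are equivalent if related by a sequence of firings. $D$ has positive rank if for every vertex $q$, $D-q$ is equivalent to an effective divisor. $\operatorname{gon}(G)$ is the minimum degree of a positive rank divisor. -}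

module Defs where

open import Data.Nat as ℕ using (ℕ; zero; suc; _∸_; _≤ᵇ_; _≡ᵇ_; _/_)
open import Data.Integer as ℤ using (ℤ; +_)
open import Data.Fin using (Fin; toℕ)
open import Data.Fin.Properties using (_≟_)
open import Data.Bool using (Bool; true; false; if_then_else_; _∨_; _∧_)
open import Data.Product using (Σ; ∃; _×_)
open import Relation.Nullary using (yes; no)
open import Relation.Binary.PropositionalEquality using (_≡_)
open import Relation.Binary.Construct.Closure.ReflexiveTransitive using (Star)

Even : ℕ → Set
Even n = ∃ λ m → n ≡ m ℕ.* 2

Odd : ℕ → Set
Odd n = ∃ λ m → n ≡ suc (m ℕ.* 2)

-- A loopless multigraph on vertex set Fin n, represented by its
-- edge-multiplicity function (mult v w = number of edges between v and w).
Multigraph : ℕ → Set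
Multigraph n = Fin n → Fin n → ℕ

sumℕ : ∀ {n} → (Fin n → ℕ) → ℕ
sumℕ {zero}  f = 0
sumℕ {suc n} f = f Fin.zero ℕ.+ sumℕ (λ i → f (Fin.suc i))
  where import Data.Fin as Fin

sumℤ : ∀ {n} → (Fin n → ℤ) → ℤ
sumℤ {zero}  f = + 0
sumℤ {suc n} f = f Fin.zero ℤ.+ sumℤ (λ i → f (Fin.suc i))
  where import Data.Fin as Fin

Divisor : ℕ → Set
Divisor n = Fin n → ℤ

deg : ∀ {n} → Divisor n → ℤ
deg = sumℤ

Effective : ∀ {n} → Divisor n → Set
Effective D = ∀ v → + 0 ℤ.≤ D v

minusPoint : ∀ {n} → Divisor n → Fin n → Divisor n
minusPoint D q w with w ≟ q
... | yes _ = D w ℤ.- + 1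
... | no  _ = D w

valence : ∀ {n} → Multigraph n → Fin n → ℕ
valence G v = sumℕ (λ w → G v w)

fire : ∀ {n} → Multigraph n → Fin n → Divisor n → Divisor n
fire G v D w with w ≟ v
... | yes _ = D w ℤ.- + valence G v
... | no  _ = D w ℤ.+ + G v w

FireStep : ∀ {n} → Multigraph n → Divisor n → Divisor n → Set
FireStep G D D′ = ∃ λ v → D′ ≡ fire G v D

Equiv : ∀ {n} → Multigraph n → Divisor n → Divisor n → Set
Equiv G D D′ = Star (FireStep G) D D′ Data.Sum.⊎ Star (FireStep G) D′ D
  where import Data.Sum

PositiveRank : ∀ {n} → Multigraph n → Divisor n → Set
PositiveRank G D = ∀ q → ∃ λ E → Effective E × Equiv G (minusPoint D q) E

-- gon(G) ≤ b  (gon is the minimum degree of a positive-rank divisor)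
-- with the bound given as a fraction b / c (c > 0): gon(G) ≤ b / c
GonAtMost : ∀ {n} → Multigraph n → (b c : ℕ) → Set
GonAtMost G b c = ∃ λ D → PositiveRank G D × (+ c) ℤ.* deg D ℤ.≤ + b

-- Harary graph H_{k,n} = Ci_n({1,…,(k-1)/2, n/2}) on vertices Fin n (v_{i+1} ↦ i)
-- cyclic difference (a - b) mod n for a, b < n
cdiff : ℕ → ℕ → ℕ → ℕ
cdiff n a b = if b ≤ᵇ a then a ∸ b else (a ℕ.+ n) ∸ b

inConn : ℕ → ℕ → ℕ → Bool
inConn k n d = ((1 ≤ᵇ d) ∧ (d ≤ᵇ ((k ∸ 1) / 2))) ∨ (d ≡ᵇ (n / 2))

hararyAdj : ℕ → ℕ → ℕ → ℕ → Bool
hararyAdj k n a b = (1 ≤ᵇ cdiff n a b) ∧ (inConn k n (cdiff n a b) ∨ inConn k n (cdiff n b a))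

hararyMult : (k n : ℕ) → Multigraph n
hararyMult k n i j = if hararyAdj k n (toℕ i) (toℕ j) then 1 else 0

-- Write k = 2r + 1 and n = 2m (so r < m), and let ‖ i ‖ be the distance from i to the nearest
-- multiple of m; the neighbours of a vertex w are w ± d (1 ≤ d ≤ r) and its antipode w + m, which
-- has the same ‖_‖.  Put g t = (r ∸ t)(r + 1 ∸ t) and D v = g ‖ v ‖; its degree is at most
-- 2 (∑_{t ≤ r} t(t+1) + ∑_{t < r} t(t+1)) = (k-1)k(k+1)/6.
-- To move the chip of D - q, let a = ‖ q ‖ and fire every vertex v exactly a ∸ ‖ v ‖ times.  Since
-- ‖ w + d ‖ + ‖ w - d ‖ ≤ 2 max(‖ w ‖, d) and a ∸ _ is convex, the pair w ± d lowers w by at most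
-- 2 (d ∸ ‖ w ‖), and these losses add up to exactly g ‖ w ‖ = D w.  At q itself nothing fires, and
-- q is paid either by D (if ‖ q ‖ = 0) or by a neighbour that is closer to mℤ and fires once.
module Submission where

open import Defs
open import Data.Nat
  using (ℕ; zero; suc; pred; _+_; _*_; _∸_; _≤_; _<_; _⊓_; ∣_-_∣; _≤ᵇ_; _≡ᵇ_; _≤?_; _<?_; _≟_;
         z≤n; s≤s; z<s; s<s; NonZero; >-nonZero; _%_; _/_)
open import Data.Nat.Properties
open import Data.Nat.DivMod
open import Data.Nat.Divisibility using (m∣m*n)
open import Data.Nat.Solver using (module +-*-Solver)
import Data.Integer as ℤ
import Data.Integer.Properties as ℤₚ
import Data.Integer.Solver as ℤ-Solver
open import Data.Fin as Fin using (Fin; toℕ)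
import Data.Fin.Properties as Finₚ
open import Data.Bool using (Bool; true; false; if_then_else_; _∧_; _∨_)
open import Data.Bool.Properties using (∨-comm; ∧-zeroʳ)
open import Data.Empty using (⊥-elim)
open import Data.Product using (_,_; _×_; ∃)
open import Data.Sum using (_⊎_; inj₁; inj₂)
open import Function using (_∘_; id)
open import Relation.Nullary using (yes; no; does)
open import Relation.Nullary.Decidable using (dec-true; dec-false)
open import Relation.Binary.PropositionalEquality
open import Relation.Binary.Construct.Closure.ReflexiveTransitive using (Star; ε; _◅_; _◅◅_)
open import Algebra.Properties.CommutativeSemigroup +-commutativeSemigroup using (interchange)

∑ : ℕ → (ℕ → ℕ) → ℕ
∑ zero    f = 0
∑ (suc n) f = f 0 + ∑ n (f ∘ suc)

syntax ∑ n (λ i → e) = ∑[ i < n ] e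

∑-cong : ∀ n {f g : ℕ → ℕ} → (∀ {i} → i < n → f i ≡ g i) → ∑ n f ≡ ∑ n g
∑-cong zero    eq = refl
∑-cong (suc n) eq = cong₂ _+_ (eq z<s) (∑-cong n (eq ∘ s<s))

∑-mono : ∀ n {f g : ℕ → ℕ} → (∀ {i} → i < n → f i ≤ g i) → ∑ n f ≤ ∑ n g
∑-mono zero    le = z≤n
∑-mono (suc n) le = +-mono-≤ (le z<s) (∑-mono n (le ∘ s<s))

∑-zero : ∀ n {f : ℕ → ℕ} → (∀ {i} → i < n → f i ≡ 0) → ∑ n f ≡ 0
∑-zero zero    eq = refl
∑-zero (suc n) eq = cong₂ _+_ (eq z<s) (∑-zero n (eq ∘ s<s))

∑-const : ∀ n c → ∑[ i < n ] c ≡ n * c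
∑-const zero    c = refl
∑-const (suc n) c = cong (c +_) (∑-const n c)

∑-head : ∀ {n} {f : ℕ → ℕ} → 0 < n → f 0 ≤ ∑ n f
∑-head {suc n} _ = m≤m+n _ _

∑-distrib-+ : ∀ n (f g : ℕ → ℕ) → ∑[ i < n ] (f i + g i) ≡ ∑ n f + ∑ n g
∑-distrib-+ zero    f g = refl
∑-distrib-+ (suc n) f g = trans (cong (f 0 + g 0 +_) (∑-distrib-+ n (f ∘ suc) (g ∘ suc)))
                                (interchange (f 0) (g 0) _ _)

∑-split : ∀ a b (f : ℕ → ℕ) → ∑ (a + b) f ≡ ∑ a f + ∑[ i < b ] f (a + i)
∑-split zero    b f = refl
∑-split (suc a) b f = trans (cong (f 0 +_) (∑-split a b (f ∘ suc))) (sym (+-assoc (f 0) _ _))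

∑-last : ∀ n (f : ℕ → ℕ) → ∑ (suc n) f ≡ ∑ n f + f n
∑-last zero    f = +-comm (f 0) 0
∑-last (suc n) f = trans (cong (f 0 +_) (∑-last n (f ∘ suc))) (sym (+-assoc (f 0) _ _))

∑-reverse : ∀ n (f : ℕ → ℕ) → ∑ n f ≡ ∑[ i < n ] f (n ∸ suc i)
∑-reverse zero    f = refl
∑-reverse (suc n) f = trans (∑-last n f) (trans (cong (_+ f n) (∑-reverse n f)) (+-comm _ (f n)))

∑-rotate : ∀ n .{{_ : NonZero n}} {w} (f : ℕ → ℕ) → w < n → ∑ n f ≡ ∑[ d < n ] f ((w + d) % n)
∑-rotate n {w} f w<n with m≤n⇒∃[o]m+o≡n (<⇒≤ w<n)
... | c , refl = begin
  ∑ (w + c) f                                                   ≡⟨ ∑-split w c f ⟩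
  ∑ w f + ∑[ d < c ] f (w + d)                                   ≡⟨ +-comm (∑ w f) _ ⟩
  ∑[ d < c ] f (w + d) + ∑ w f
    ≡⟨ cong₂ _+_ (∑-cong c (cong f ∘ front)) (∑-cong w (cong f ∘ back)) ⟩
  ∑[ d < c ] f ((w + d) % n) + ∑[ d < w ] f ((w + (c + d)) % n)  ≡⟨ ∑-split c w f′ ⟨
  ∑ (c + w) f′                                                  ≡⟨ cong (λ l → ∑ l f′) (+-comm c w) ⟩
  ∑ (w + c) f′                                                  ∎
  where
  open ≡-Reasoning
  f′ : ℕ → ℕ
  f′ d = f ((w + d) % n)
  front : ∀ {d} → d < c → w + d ≡ (w + d) % n
  front d<c = sym (m<n⇒m%n≡m (+-monoʳ-< w d<c))
  back : ∀ {d} → d < w → d ≡ (w + (c + d)) % n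
  back {d} d<w = sym (begin
    (w + (c + d)) % n ≡⟨ cong (_% n) (trans (sym (+-assoc w c d)) (+-comm n d)) ⟩
    (d + n) % n       ≡⟨ [m+n]%n≡m%n d n ⟩
    d % n             ≡⟨ m<n⇒m%n≡m (<-≤-trans d<w (m≤m+n w c)) ⟩
    d                 ∎)

sumℕ-∑ : ∀ n (f : ℕ → ℕ) → sumℕ {n} (f ∘ toℕ) ≡ ∑ n f
sumℕ-∑ zero    f = refl
sumℕ-∑ (suc n) f = cong (f 0 +_) (sumℕ-∑ n (f ∘ suc))

sumℕ-zero : ∀ {n} {f : Fin n → ℕ} → (∀ v → f v ≡ 0) → sumℕ f ≡ 0
sumℕ-zero {zero}  eq = refl
sumℕ-zero {suc n} eq = cong₂ _+_ (eq Fin.zero) (sumℕ-zero (eq ∘ Fin.suc))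

sumℕ-single : ∀ {n} {f : Fin n → ℕ} w → (∀ v → v ≢ w → f v ≡ 0) → sumℕ f ≡ f w
sumℕ-single {suc n} {f} Fin.zero    eq =
  trans (cong (f Fin.zero +_) (sumℕ-zero (λ v → eq (Fin.suc v) λ ()))) (+-identityʳ _)
sumℕ-single {suc n}     (Fin.suc w) eq =
  cong₂ _+_ (eq Fin.zero λ ()) (sumℕ-single w (λ v v≢w → eq (Fin.suc v) (v≢w ∘ Finₚ.suc-injective)))

sumℤ-pos : ∀ {n} (f : Fin n → ℕ) → sumℤ (ℤ.+_ ∘ f) ≡ ℤ.+ sumℕ f
sumℤ-pos {zero}  f = refl
sumℤ-pos {suc n} f = cong (ℤ._+_ (ℤ.+ f Fin.zero)) (sumℤ-pos (f ∘ Fin.suc))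

-- Divisors are compared through balance equations  x ⊕ a ≡ y ⊕ b  with chip counts a, b : ℕ,
-- which keeps all bookkeeping about firings free of subtraction.
infixl 6 _⊕_
_⊕_ : ℤ.ℤ → ℕ → ℤ.ℤ
x ⊕ a = x ℤ.+ ℤ.+ a

balance-trans : ∀ x y z {a b c d} → x ⊕ a ≡ y ⊕ b → y ⊕ c ≡ z ⊕ d → x ⊕ (c + a) ≡ z ⊕ (d + b)
balance-trans x y z {a} {b} {c} {d} xy yz = begin
  x ⊕ (c + a)         ≡⟨ solve 3 (λ x a c → x :+ (c :+ a) := (x :+ a) :+ c) refl x (ℤ.+ a) (ℤ.+ c) ⟩
  x ⊕ a ⊕ c           ≡⟨ cong (_⊕ c) xy ⟩
  y ⊕ b ⊕ c           ≡⟨ solve 3 (λ y b c → (y :+ b) :+ c := (y :+ c) :+ b) refl y (ℤ.+ b) (ℤ.+ c) ⟩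
  y ⊕ c ⊕ b           ≡⟨ cong (_⊕ b) yz ⟩
  z ⊕ d ⊕ b           ≡⟨ ℤₚ.+-assoc z (ℤ.+ d) (ℤ.+ b) ⟩
  z ⊕ (d + b)         ∎
  where
  open ≡-Reasoning
  open ℤ-Solver.+-*-Solver

balance⇒nonNegative : ∀ {x a b} → x ⊕ a ≡ ℤ.+ b → a ≤ b → ℤ.+ 0 ℤ.≤ x
balance⇒nonNegative {x} {a} {b} eq a≤b = subst (ℤ.+ 0 ℤ.≤_) b-a≡x (ℤₚ.i≤j⇒0≤j-i (ℤ.+≤+ a≤b))
  where
  open ℤ-Solver.+-*-Solver
  b-a≡x : ℤ.+ b ℤ.- ℤ.+ a ≡ x
  b-a≡x = trans (cong (ℤ._- ℤ.+ a) (sym eq)) (solve 2 (λ x a → (x :+ a) :- a := x) refl x (ℤ.+ a))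

module ChipFiring {n} (G : Multigraph n) (loopless : ∀ v → G v v ≡ 0) where

  loss : Fin n → Fin n → ℕ
  loss v w = if does (w Finₚ.≟ v) then valence G v else 0

  fire-balance : ∀ v D w → fire G v D w ⊕ loss v w ≡ D w ⊕ G v w
  fire-balance v D w with w Finₚ.≟ v
  ... | yes refl = begin
    D w ℤ.- ℤ.+ valence G w ⊕ valence G w
      ≡⟨ solve 2 (λ x a → x :- a :+ a := x :+ con (ℤ.+ 0)) refl (D w) (ℤ.+ valence G w) ⟩
    D w ⊕ 0      ≡⟨ cong (D w ⊕_) (sym (loopless w)) ⟩
    D w ⊕ G w w  ∎
    where
    open ≡-Reasoning
    open ℤ-Solver.+-*-Solver
  ... | no _ = ℤₚ.+-identityʳ _

  fireTimes : ℕ → Fin n → Divisor n → Divisor n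
  fireTimes zero    v D = D
  fireTimes (suc c) v D = fireTimes c v (fire G v D)

  fireTimes-reachable : ∀ c v D → Star (FireStep G) D (fireTimes c v D)
  fireTimes-reachable zero    v D = ε
  fireTimes-reachable (suc c) v D = (v , refl) ◅ fireTimes-reachable c v (fire G v D)

  fireTimes-balance : ∀ c v D w → fireTimes c v D w ⊕ c * loss v w ≡ D w ⊕ c * G v w
  fireTimes-balance zero    v D w = refl
  fireTimes-balance (suc c) v D w =
    balance-trans (fireTimes c v (fire G v D) w) (fire G v D w) (D w)
                  (fireTimes-balance c v (fire G v D) w) (fire-balance v D w)

  -- σ lists the vertices in the order they fire; it is arbitrary only so that induction on k works.
  fireAll : ∀ {k} → (Fin k → Fin n) → (Fin n → ℕ) → Divisor n → Divisor n
  fireAll {zero}  σ φ D = D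
  fireAll {suc k} σ φ D = fireAll (σ ∘ Fin.suc) φ (fireTimes (φ (σ Fin.zero)) (σ Fin.zero) D)

  fireAll-reachable : ∀ {k} (σ : Fin k → Fin n) φ D → Star (FireStep G) D (fireAll σ φ D)
  fireAll-reachable {zero}  σ φ D = ε
  fireAll-reachable {suc k} σ φ D =
    fireTimes-reachable (φ (σ Fin.zero)) (σ Fin.zero) D ◅◅ fireAll-reachable (σ ∘ Fin.suc) φ _

  fireAll-balance : ∀ {k} (σ : Fin k → Fin n) φ D w →
    fireAll σ φ D w ⊕ sumℕ (λ i → φ (σ i) * loss (σ i) w) ≡ D w ⊕ sumℕ (λ i → φ (σ i) * G (σ i) w)
  fireAll-balance {zero}  σ φ D w = refl
  fireAll-balance {suc k} σ φ D w =
    balance-trans (fireAll (σ ∘ Fin.suc) φ D′ w) (D′ w) (D w)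
                  (fireAll-balance (σ ∘ Fin.suc) φ D′ w)
                  (fireTimes-balance (φ (σ Fin.zero)) (σ Fin.zero) D w)
    where D′ = fireTimes (φ (σ Fin.zero)) (σ Fin.zero) D

  fireAll-id-balance : ∀ φ D w →
    fireAll id φ D w ⊕ φ w * valence G w ≡ D w ⊕ sumℕ (λ v → φ v * G v w)
  fireAll-id-balance φ D w =
    subst (λ l → fireAll id φ D w ⊕ l ≡ D w ⊕ sumℕ (λ v → φ v * G v w)) totalLoss
          (fireAll-balance id φ D w)
    where
    noLoss : ∀ v → v ≢ w → φ v * loss v w ≡ 0
    noLoss v v≢w with w Finₚ.≟ v
    ... | yes w≡v = ⊥-elim (v≢w (sym w≡v))
    ... | no _    = *-zeroʳ (φ v)
    totalLoss : sumℕ (λ v → φ v * loss v w) ≡ φ w * valence G w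
    totalLoss = trans (sumℕ-single w noLoss)
                      (cong (λ b → φ w * (if b then valence G w else 0)) (dec-true (w Finₚ.≟ w) refl))

  positiveRank-by-scripts : (D : Fin n → ℕ) →
    (∀ q → ∃ λ φ → (∀ w → φ w * valence G w ≤ D w + sumℕ (λ v → φ v * G v w))
                 × φ q * valence G q < D q + sumℕ (λ v → φ v * G v q)) →
    PositiveRank G (ℤ.+_ ∘ D)
  positiveRank-by-scripts D scripts q with scripts q
  ... | φ , bounded , strict = E , effective , inj₁ (fireAll-reachable id φ _)
    where
    E = fireAll id φ (minusPoint (ℤ.+_ ∘ D) q)
    effective : Effective E
    effective w with w Finₚ.≟ q | fireAll-id-balance φ (minusPoint (ℤ.+_ ∘ D) q) w
    ... | no _     | eq = balance⇒nonNegative eq (bounded w)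
    ... | yes refl | eq = balance⇒nonNegative (begin
      E q ⊕ (1 + a)
        ≡⟨ solve 3 (λ e a o → e :+ (o :+ a) := (e :+ a) :+ o) refl (E q) (ℤ.+ a) (ℤ.+ 1) ⟩
      E q ⊕ a ⊕ 1
        ≡⟨ cong (_⊕ 1) eq ⟩
      ℤ.+ D q ℤ.- ℤ.+ 1 ⊕ inflow ⊕ 1
        ≡⟨ solve 3 (λ d i o → (d :- o :+ i) :+ o := d :+ i) refl (ℤ.+ D q) (ℤ.+ inflow) (ℤ.+ 1) ⟩
      ℤ.+ (D q + inflow)
        ∎) strict
      where
      open ≡-Reasoning
      open ℤ-Solver.+-*-Solver
      a = φ q * valence G q
      inflow = sumℕ (λ v → φ v * G v q)

m+n+∣m-n∣≡2*m+2*[n∸m] : ∀ a b → a + b + ∣ a - b ∣ ≡ 2 * a + 2 * (b ∸ a)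
m+n+∣m-n∣≡2*m+2*[n∸m] a b with ≤-total a b
... | inj₁ a≤b with m≤n⇒∃[o]m+o≡n a≤b
...   | o , refl rewrite ∣m-m+n∣≡n a o | m+n∸m≡n a o =
  solve 2 (λ a o → a :+ (a :+ o) :+ o := con 2 :* a :+ con 2 :* o) refl a o
  where open +-*-Solver
m+n+∣m-n∣≡2*m+2*[n∸m] a b | inj₂ b≤a with m≤n⇒∃[o]m+o≡n b≤a
...   | o , refl rewrite m≤n⇒m∸n≡0 (m≤m+n b o) | ∣-∣-comm (b + o) b | ∣m-m+n∣≡n b o =
  solve 2 (λ b o → b :+ o :+ b :+ o := con 2 :* (b :+ o) :+ con 2 :* con 0) refl b o
  where open +-*-Solver

∸-convex : ∀ a {t e r₁ r₂} → r₁ + r₂ ≤ 2 * t + 2 * e → 2 * (a ∸ t) ≤ (a ∸ r₁) + (a ∸ r₂) + 2 * e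
∸-convex a {t} {e} {r₁} {r₂} r₁+r₂≤ = begin
  2 * (a ∸ t)        ≡⟨ *-distribˡ-∸ 2 a t ⟩
  2 * a ∸ 2 * t      ≤⟨ m≤n+o⇒m∸n≤o (2 * a) (2 * t) 2a≤ ⟩
  S + 2 * e          ∎
  where
  open ≤-Reasoning
  open +-*-Solver
  S = (a ∸ r₁) + (a ∸ r₂)
  2a≤ : 2 * a ≤ 2 * t + (S + 2 * e)
  2a≤ = begin
    2 * a                              ≡⟨ cong (a +_) (+-identityʳ a) ⟩
    a + a                              ≤⟨ +-mono-≤ (m≤n+m∸n a r₁) (m≤n+m∸n a r₂) ⟩
    (r₁ + (a ∸ r₁)) + (r₂ + (a ∸ r₂))  ≡⟨ interchange r₁ (a ∸ r₁) r₂ (a ∸ r₂) ⟩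
    (r₁ + r₂) + S                      ≤⟨ +-monoˡ-≤ S r₁+r₂≤ ⟩
    (2 * t + 2 * e) + S                ≡⟨ solve 3 (λ t e s → (t :+ e) :+ s := t :+ (s :+ e)) refl (2 * t) (2 * e) S ⟩
    2 * t + (S + 2 * e)                ∎

∑-deficit : ∀ r t → ∑[ e < r ] (2 * (suc e ∸ t)) ≡ (r ∸ t) * (suc r ∸ t)
∑-deficit zero    t rewrite 0∸n≡0 t = refl
∑-deficit (suc r) t =
  trans (∑-last r _) (trans (cong (_+ 2 * (suc r ∸ t)) (∑-deficit r t)) (add-last r t))
  where
  open +-*-Solver
  add-last : ∀ r t → (r ∸ t) * (suc r ∸ t) + 2 * (suc r ∸ t) ≡ (suc r ∸ t) * (suc (suc r) ∸ t)
  add-last r t with ≤-total t r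
  ... | inj₁ t≤r rewrite +-∸-assoc 1 t≤r | +-∸-assoc 2 t≤r =
    solve 1 (λ u → u :* (con 1 :+ u) :+ con 2 :* (con 1 :+ u) := (con 1 :+ u) :* (con 2 :+ u)) refl (r ∸ t)
  ... | inj₂ r≤t with suc r ≤? t
  ...   | yes 1+r≤t rewrite m≤n⇒m∸n≡0 r≤t | m≤n⇒m∸n≡0 1+r≤t = refl
  ...   | no 1+r≰t with ≤-antisym r≤t (≤-pred (≰⇒> 1+r≰t))
  ...     | refl rewrite n∸n≡0 r | m+n∸n≡m 1 r | m+n∸n≡m 2 r = refl

∑-pronic : ∀ r N → r ≤ N → 3 * ∑[ i < N ] ((r ∸ suc i) * (r ∸ i)) ≡ (r ∸ 1) * r * suc r
∑-pronic zero    N       _         = cong (3 *_) (∑-zero N (λ _ → refl))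
∑-pronic (suc r) (suc N) (s≤s r≤N) = begin
  3 * (r * suc r + T)               ≡⟨ *-distribˡ-+ 3 (r * suc r) T ⟩
  3 * (r * suc r) + 3 * T           ≡⟨ cong (3 * (r * suc r) +_) (∑-pronic r N r≤N) ⟩
  3 * (r * suc r) + (r ∸ 1) * r * suc r ≡⟨ add-first r ⟩
  r * suc r * suc (suc r)           ∎
  where
  open ≡-Reasoning
  open +-*-Solver
  T = ∑[ i < N ] ((r ∸ suc i) * (r ∸ i))
  add-first : ∀ r → 3 * (r * suc r) + (r ∸ 1) * r * suc r ≡ r * suc r * suc (suc r)
  add-first zero    = refl
  add-first (suc r) = solve 1 (λ r → con 3 :* ((con 1 :+ r) :* (con 2 :+ r)) :+ r :* (con 1 :+ r) :* (con 2 :+ r)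
                                   := (con 1 :+ r) :* (con 2 :+ r) :* (con 3 :+ r)) refl r

-- Throughout, x + (m ∸ d) stands for x − d modulo m.
module NearestMultiple (m : ℕ) .{{_ : NonZero m}} where

  opaque
    ‖_‖ : ℕ → ℕ
    ‖ i ‖ = i % m ⊓ (m ∸ i % m)

    ‖‖-cong : ∀ {i j} → i % m ≡ j % m → ‖ i ‖ ≡ ‖ j ‖
    ‖‖-cong = cong (λ x → x ⊓ (m ∸ x))

    ‖‖-< : ∀ {x} → x < m → ‖ x ‖ ≡ x ⊓ (m ∸ x)
    ‖‖-< x<m = cong (λ x → x ⊓ (m ∸ x)) (m<n⇒m%n≡m x<m)

    ‖‖≤% : ∀ i → ‖ i ‖ ≤ i % m
    ‖‖≤% i = m⊓n≤m _ _

    ‖‖≤∸% : ∀ i → ‖ i ‖ ≤ m ∸ i % m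
    ‖‖≤∸% i = m⊓n≤n _ _

  ‖‖-periodic : ∀ i j → ‖ i + j * m ‖ ≡ ‖ i ‖
  ‖‖-periodic i j = ‖‖-cong ([m+kn]%n≡m%n i j m)

  ‖m+‖ : ∀ i → ‖ m + i ‖ ≡ ‖ i ‖
  ‖m+‖ i = trans (cong ‖_‖ (trans (+-comm m i) (cong (i +_) (sym (*-identityˡ m))))) (‖‖-periodic i 1)

  ‖‖≤ : ∀ i → ‖ i ‖ ≤ i
  ‖‖≤ i = ≤-trans (‖‖≤% i) (m%n≤m i m)

  ‖‖≤∣-∣ : ∀ j i → ‖ i ‖ ≤ ∣ i - j * m ∣
  ‖‖≤∣-∣ zero    i = subst (‖ i ‖ ≤_) (sym (∣-∣-identityʳ i)) (‖‖≤ i)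
  ‖‖≤∣-∣ (suc j) i with m ≤? i
  ... | yes m≤i with m≤n⇒∃[o]m+o≡n m≤i
  ...   | i′ , refl = begin
    ‖ m + i′ ‖          ≡⟨ ‖m+‖ i′ ⟩
    ‖ i′ ‖              ≤⟨ ‖‖≤∣-∣ j i′ ⟩
    ∣ i′ - j * m ∣      ≡⟨ ∣m+n-m+o∣≡∣n-o∣ m i′ (j * m) ⟨
    ∣ m + i′ - m + j * m ∣ ∎
    where open ≤-Reasoning
  ‖‖≤∣-∣ (suc j) i | no m≰i = begin
    ‖ i ‖                ≤⟨ ‖‖≤∸% i ⟩
    m ∸ i % m            ≡⟨ cong (m ∸_) (m<n⇒m%n≡m i<m) ⟩
    m ∸ i                ≤⟨ ∸-monoˡ-≤ i (m≤m+n m (j * m)) ⟩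
    m + j * m ∸ i        ≡⟨ m≤n⇒∣m-n∣≡n∸m (<⇒≤ (<-≤-trans i<m (m≤m+n m (j * m)))) ⟨
    ∣ i - m + j * m ∣    ∎
    where
    open ≤-Reasoning
    i<m = ≰⇒> m≰i

  ‖‖-% : ∀ y → ‖ y % m ‖ ≡ ‖ y ‖
  ‖‖-% y = ‖‖-cong (m%n%n≡m%n y m)

  ‖+‖-% : ∀ y e → ‖ y + e ‖ ≡ ‖ y % m + e ‖
  ‖+‖-% y e = trans (cong ‖_‖ y+e≡) (‖‖-periodic (y % m + e) (y / m))
    where
    open +-*-Solver
    y+e≡ : y + e ≡ y % m + e + y / m * m
    y+e≡ = trans (cong (_+ e) (m≡m%n+[m/n]*n y m))
                 (solve 3 (λ r q e → r :+ q :+ e := r :+ e :+ q) refl (y % m) (y / m * m) e)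

  ‖+‖≤∣-∣ : ∀ {x} d → x ≤ m → ‖ x + d ‖ ≤ ∣ d - (m ∸ x) ∣
  ‖+‖≤∣-∣ {x} d x≤m = begin
    ‖ x + d ‖                  ≤⟨ ‖‖≤∣-∣ 1 (x + d) ⟩
    ∣ x + d - 1 * m ∣          ≡⟨ cong (∣ x + d -_∣) (trans (*-identityˡ m) (sym (m+[n∸m]≡n x≤m))) ⟩
    ∣ x + d - x + (m ∸ x) ∣    ≡⟨ ∣m+n-m+o∣≡∣n-o∣ x d (m ∸ x) ⟩
    ∣ d - (m ∸ x) ∣            ∎
    where open ≤-Reasoning

  ‖+∸‖≤∣-∣ : ∀ x {d} → d ≤ m → ‖ x + (m ∸ d) ‖ ≤ ∣ x - d ∣
  ‖+∸‖≤∣-∣ x {d} d≤m = begin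
    ‖ x + (m ∸ d) ‖                ≤⟨ ‖‖≤∣-∣ 1 (x + (m ∸ d)) ⟩
    ∣ x + (m ∸ d) - 1 * m ∣
      ≡⟨ cong₂ ∣_-_∣ (+-comm x (m ∸ d)) (trans (*-identityˡ m) (sym (m∸n+n≡m d≤m))) ⟩
    ∣ (m ∸ d) + x - (m ∸ d) + d ∣  ≡⟨ ∣m+n-m+o∣≡∣n-o∣ (m ∸ d) x d ⟩
    ∣ x - d ∣                      ∎
    where open ≤-Reasoning

  ‖+∸‖≤+ : ∀ {x d} → x ≤ m → d ≤ m → ‖ x + (m ∸ d) ‖ ≤ (m ∸ x) + d
  ‖+∸‖≤+ {x} {d} x≤m d≤m = begin
    ‖ y ‖                ≤⟨ ‖‖≤∣-∣ 2 y ⟩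
    ∣ y - 2 * m ∣        ≡⟨ m≤n⇒∣m-n∣≡n∸m (subst (y ≤_) (sym 2m≡) (m≤m+n y _)) ⟩
    2 * m ∸ y            ≤⟨ m≤n+o⇒m∸n≤o (2 * m) y (≤-reflexive 2m≡) ⟩
    (m ∸ x) + d          ∎
    where
    open ≤-Reasoning
    open +-*-Solver
    y = x + (m ∸ d)
    2m≡ : 2 * m ≡ y + ((m ∸ x) + d)
    2m≡ = begin-equality
      2 * m
        ≡⟨ cong₂ (λ a b → a + (b + 0)) (m+[n∸m]≡n x≤m) (m∸n+n≡m d≤m) ⟨
      (x + (m ∸ x)) + (((m ∸ d) + d) + 0)
        ≡⟨ solve 4 (λ x a b d → (x :+ a) :+ ((b :+ d) :+ con 0) := x :+ b :+ (a :+ d)) refl x (m ∸ x) (m ∸ d) d ⟩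
      y + ((m ∸ x) + d)
        ∎

  ‖‖-midpoint-< : ∀ {x d} → x < m → d ≤ m →
                  ‖ x + d ‖ + ‖ x + (m ∸ d) ‖ ≤ 2 * ‖ x ‖ + 2 * (d ∸ ‖ x ‖)
  ‖‖-midpoint-< {x} {d} x<m d≤m rewrite ‖‖-< x<m with ⊓-sel x (m ∸ x)
  ... | inj₁ t≡x rewrite t≡x = begin
    ‖ x + d ‖ + ‖ x + (m ∸ d) ‖    ≤⟨ +-mono-≤ (‖‖≤ (x + d)) (‖+∸‖≤∣-∣ x d≤m) ⟩
    x + d + ∣ x - d ∣              ≡⟨ m+n+∣m-n∣≡2*m+2*[n∸m] x d ⟩
    2 * x + 2 * (d ∸ x)            ∎
    where open ≤-Reasoning
  ... | inj₂ t≡m∸x rewrite t≡m∸x = begin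
    ‖ x + d ‖ + ‖ x + (m ∸ d) ‖    ≤⟨ +-mono-≤ (‖+‖≤∣-∣ d x≤m) (‖+∸‖≤+ x≤m d≤m) ⟩
    ∣ d - t ∣ + (t + d)            ≡⟨ +-comm ∣ d - t ∣ (t + d) ⟩
    t + d + ∣ d - t ∣              ≡⟨ cong (t + d +_) (∣-∣-comm d t) ⟩
    t + d + ∣ t - d ∣              ≡⟨ m+n+∣m-n∣≡2*m+2*[n∸m] t d ⟩
    2 * t + 2 * (d ∸ t)            ∎
    where
    open ≤-Reasoning
    t = m ∸ x
    x≤m = <⇒≤ x<m

  ‖‖-midpoint : ∀ y {d} → d ≤ m → ‖ y + d ‖ + ‖ y + (m ∸ d) ‖ ≤ 2 * ‖ y ‖ + 2 * (d ∸ ‖ y ‖)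
  ‖‖-midpoint y {d} d≤m = begin
    ‖ y + d ‖ + ‖ y + (m ∸ d) ‖    ≡⟨ cong₂ _+_ (‖+‖-% y d) (‖+‖-% y (m ∸ d)) ⟩
    ‖ x + d ‖ + ‖ x + (m ∸ d) ‖    ≤⟨ ‖‖-midpoint-< (m%n<n y m) d≤m ⟩
    2 * ‖ x ‖ + 2 * (d ∸ ‖ x ‖)    ≡⟨ cong (λ t → 2 * t + 2 * (d ∸ t)) (‖‖-% y) ⟩
    2 * ‖ y ‖ + 2 * (d ∸ ‖ y ‖)    ∎
    where
    open ≤-Reasoning
    x = y % m

  ‖‖-descent-< : ∀ {x} → x < m → 0 < ‖ x ‖ → ‖ x + 1 ‖ < ‖ x ‖ ⊎ ‖ x + (m ∸ 1) ‖ < ‖ x ‖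
  ‖‖-descent-< {x} x<m 0<t rewrite ‖‖-< x<m with ⊓-sel x (m ∸ x)
  ... | inj₁ t≡x rewrite t≡x =
    inj₂ (≤-<-trans (‖+∸‖≤∣-∣ x (<⇒≤ (≤-<-trans 0<t x<m))) (∣t-1∣<t 0<t))
    where
    ∣t-1∣<t : ∀ {t} → 0 < t → ∣ t - 1 ∣ < t
    ∣t-1∣<t {suc t} _ = subst (_< suc t) (sym (∣-∣-identityʳ t)) ≤-refl
  ... | inj₂ t≡m∸x rewrite t≡m∸x = inj₁ (≤-<-trans (‖+‖≤∣-∣ 1 (<⇒≤ x<m)) (∣1-t∣<t 0<t))
    where
    ∣1-t∣<t : ∀ {t} → 0 < t → ∣ 1 - t ∣ < t
    ∣1-t∣<t {suc t} _ = ≤-refl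

  ‖‖-descent : ∀ y → 0 < ‖ y ‖ → ‖ y + 1 ‖ < ‖ y ‖ ⊎ ‖ y + (m ∸ 1) ‖ < ‖ y ‖
  ‖‖-descent y 0<t
    with ‖‖-descent-< (m%n<n y m) (subst (0 <_) (sym (‖‖-% y)) 0<t)
  ... | inj₁ lt = inj₁ (subst₂ _<_ (sym (‖+‖-% y 1)) (‖‖-% y) lt)
  ... | inj₂ lt = inj₂ (subst₂ _<_ (sym (‖+‖-% y (m ∸ 1))) (‖‖-% y) lt)

≤ᵇ-true : ∀ {a b} → a ≤ b → (a ≤ᵇ b) ≡ true
≤ᵇ-true a≤b = dec-true (_ ≤? _) a≤b

≤ᵇ-false : ∀ {a b} → b < a → (a ≤ᵇ b) ≡ false
≤ᵇ-false b<a = dec-false (_ ≤? _) (<⇒≱ b<a)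

≡ᵇ-true : ∀ a → (a ≡ᵇ a) ≡ true
≡ᵇ-true a = dec-true (a ≟ a) refl

≡ᵇ-false : ∀ {a b} → a ≢ b → (a ≡ᵇ b) ≡ false
≡ᵇ-false a≢b = dec-false (_ ≟ _) a≢b

cdiff-≤ : ∀ n {a b} → b ≤ a → cdiff n a b ≡ a ∸ b
cdiff-≤ n b≤a rewrite ≤ᵇ-true b≤a = refl

cdiff-> : ∀ n {a b} → a < b → cdiff n a b ≡ a + n ∸ b
cdiff-> n a<b rewrite ≤ᵇ-false a<b = refl

cdiff-self : ∀ n a → cdiff n a a ≡ 0
cdiff-self n a = trans (cdiff-≤ n (≤-refl {a})) (n∸n≡0 a)

module _ (n : ℕ) .{{_ : NonZero n}} where

  cdiff-offset : ∀ {w d} → w < n → d < n → cdiff n ((w + d) % n) w ≡ d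
  cdiff-offset {w} {d} w<n d<n with w + d <? n
  ... | yes w+d<n = begin
    cdiff n ((w + d) % n) w  ≡⟨ cong (λ u → cdiff n u w) (m<n⇒m%n≡m w+d<n) ⟩
    cdiff n (w + d) w        ≡⟨ cdiff-≤ n (m≤m+n w d) ⟩
    w + d ∸ w                ≡⟨ m+n∸m≡n w d ⟩
    d                        ∎
    where open ≡-Reasoning
  ... | no w+d≮n = begin
    cdiff n ((w + d) % n) w
      ≡⟨ cong (λ u → cdiff n u w) (trans (sym (m≤n⇒[n∸m]%m≡n%m n≤w+d)) (m<n⇒m%n≡m u<n)) ⟩
    cdiff n u w              ≡⟨ cdiff-> n u<w ⟩
    u + n ∸ w                ≡⟨ cong (_∸ w) (m∸n+n≡m n≤w+d) ⟩
    w + d ∸ w                ≡⟨ m+n∸m≡n w d ⟩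
    d                        ∎
    where
    open ≡-Reasoning
    n≤w+d = ≮⇒≥ w+d≮n
    u = w + d ∸ n
    u<n : u < n
    u<n = m<n+o⇒m∸n<o (w + d) n (+-mono-< w<n d<n)
    u<w : u < w
    u<w = subst (u <_) (m+n∸n≡m w n) (∸-monoˡ-< (+-monoʳ-< w d<n) n≤w+d)

  [[w+d]%n+[n∸d]]%n≡w : ∀ {w d} → w < n → d ≤ n → ((w + d) % n + (n ∸ d)) % n ≡ w
  [[w+d]%n+[n∸d]]%n≡w {w} {d} w<n d≤n = begin
    ((w + d) % n + (n ∸ d)) % n     ≡⟨ [m%n+o]%n≡[m+o]%n (w + d) (n ∸ d) ⟩
    (w + d + (n ∸ d)) % n           ≡⟨ cong (_% n) (trans (+-assoc w d (n ∸ d)) (cong (w +_) (m+[n∸m]≡n d≤n))) ⟩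
    (w + n) % n                     ≡⟨ [m+n]%n≡m%n w n ⟩
    w % n                           ≡⟨ m<n⇒m%n≡m w<n ⟩
    w                               ∎
    where
    open ≡-Reasoning
    [m%n+o]%n≡[m+o]%n : ∀ a b → (a % n + b) % n ≡ (a + b) % n
    [m%n+o]%n≡[m+o]%n a b = trans (%-distribˡ-+ (a % n) b n)
      (trans (cong (λ x → (x + b % n) % n) (m%n%n≡m%n a n)) (sym (%-distribˡ-+ a b n)))

  cdiff-offset⁻ : ∀ {w d} → w < n → 0 < d → d < n → cdiff n w ((w + d) % n) ≡ n ∸ d
  cdiff-offset⁻ {w} {d} w<n 0<d d<n = begin
    cdiff n w u                         ≡⟨ cong (λ v → cdiff n v u) ([[w+d]%n+[n∸d]]%n≡w w<n (<⇒≤ d<n)) ⟨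
    cdiff n ((u + (n ∸ d)) % n) u       ≡⟨ cdiff-offset (m%n<n (w + d) n) (∸-monoʳ-< 0<d (<⇒≤ d<n)) ⟩
    n ∸ d                               ∎
    where
    open ≡-Reasoning
    u = (w + d) % n

iverson : Bool → ℕ
iverson b = if b then 1 else 0

module HararyGraph (r m : ℕ) (r<m : r < m) where

  k n : ℕ
  k = suc (r * 2)
  n = m * 2

  0<m : 0 < m
  0<m = ≤-<-trans z≤n r<m

  instance
    m-nonZero : NonZero m
    m-nonZero = >-nonZero 0<m
    n-nonZero : NonZero n
    n-nonZero = >-nonZero (*-monoˡ-< 2 0<m)

  n≡m+m : n ≡ m + m
  n≡m+m = trans (*-comm m 2) (cong (m +_) (+-identityʳ m))

  m<n : m < n
  m<n = subst (m <_) (sym n≡m+m) (m<m+n m 0<m)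

  connects : ℕ → Bool
  connects d = (1 ≤ᵇ d) ∧ (inConn k n d ∨ inConn k n (n ∸ d))

  connects-swap : ∀ {d} → suc d < n →
    (1 ≤ᵇ n ∸ suc d) ∧ (inConn k n (n ∸ suc d) ∨ inConn k n (suc d)) ≡ connects (suc d)
  connects-swap {d} d<n =
    cong₂ _∧_ (≤ᵇ-true (m<n⇒0<n∸m d<n)) (∨-comm (inConn k n (n ∸ suc d)) (inConn k n (suc d)))

  adjacent-in : ∀ {w d} → w < n → d < n → hararyAdj k n ((w + d) % n) w ≡ connects d
  adjacent-in {w} {zero}  w<n _   rewrite +-identityʳ w | m<n⇒m%n≡m w<n | cdiff-self n w = refl
  adjacent-in {w} {suc d} w<n d<n rewrite cdiff-offset n w<n d<n | cdiff-offset⁻ n w<n z<s d<n = refl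

  adjacent-out : ∀ {w d} → w < n → d < n → hararyAdj k n w ((w + d) % n) ≡ connects d
  adjacent-out {w} {zero}  w<n _   rewrite +-identityʳ w | m<n⇒m%n≡m w<n | cdiff-self n w = refl
  adjacent-out {w} {suc d} w<n d<n
    rewrite cdiff-offset n w<n d<n | cdiff-offset⁻ n w<n z<s d<n = connects-swap d<n

  connects-sym : ∀ {d} → 0 < d → d < n → connects (n ∸ d) ≡ connects d
  connects-sym {suc d} _ d<n rewrite m∸[m∸n]≡n (<⇒≤ d<n) = connects-swap d<n

  inConn-eq : ∀ d → inConn k n d ≡ ((1 ≤ᵇ d) ∧ (d ≤ᵇ r)) ∨ (d ≡ᵇ m)
  inConn-eq d rewrite m*n/n≡m r 2 {{_}} | m*n/n≡m m 2 {{_}} = refl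

  connects-low : ∀ {d} → 0 < d → d ≤ r → connects d ≡ true
  connects-low {d} 0<d d≤r rewrite inConn-eq d | ≤ᵇ-true 0<d | ≤ᵇ-true d≤r = refl

  connects-half : connects m ≡ true
  connects-half rewrite inConn-eq m | ≤ᵇ-true 0<m | ≤ᵇ-false r<m | ≡ᵇ-true m = refl

  n∸m≡m : n ∸ m ≡ m
  n∸m≡m = trans (cong (_∸ m) n≡m+m) (m+n∸n≡m m m)

  m<n∸ : ∀ {d} → d < m → m < n ∸ d
  m<n∸ {d} d<m = subst (_< n ∸ d) n∸m≡m (∸-monoʳ-< d<m (<⇒≤ m<n))

  connects-mid : ∀ {d} → r < d → d < m → connects d ≡ false
  connects-mid {d} r<d d<m
    rewrite inConn-eq d | inConn-eq (n ∸ d) | ≤ᵇ-true (≤-<-trans z≤n r<d)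
          | ≤ᵇ-false r<d | ≡ᵇ-false (<⇒≢ d<m)
          | ≤ᵇ-false (<-trans r<m (m<n∸ d<m)) | ≡ᵇ-false (>⇒≢ (m<n∸ d<m)) = cong (_∨ false) (∧-zeroʳ _)

  lower-half : ∀ (f : ℕ → ℕ) → ∑[ e < pred m ] (f e * iverson (connects (suc e))) ≡ ∑ r f
  lower-half f = begin
    ∑ (pred m) F                                    ≡⟨ cong (λ l → ∑ l F) (m+[n∸m]≡n r≤m′) ⟨
    ∑ (r + L) F                                     ≡⟨ ∑-split r L F ⟩
    ∑ r F + ∑[ e < L ] F (r + e)                    ≡⟨ cong₂ _+_ (∑-cong r low) (∑-zero L mid) ⟩
    ∑ r f + 0                                       ≡⟨ +-identityʳ (∑ r f) ⟩
    ∑ r f                                           ∎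
    where
    open ≡-Reasoning
    F : ℕ → ℕ
    F e = f e * iverson (connects (suc e))
    r≤m′ = <⇒≤pred r<m
    L = pred m ∸ r
    low : ∀ {e} → e < r → F e ≡ f e
    low {e} e<r = trans (cong (λ b → f e * iverson b) (connects-low z<s e<r)) (*-identityʳ (f e))
    1+r+e<m : ∀ {e} → e < L → suc (r + e) < m
    1+r+e<m e<L = subst (_ <_) (trans (cong suc (m+[n∸m]≡n r≤m′)) (suc-pred m)) (s<s (+-monoʳ-< r e<L))
    mid : ∀ {e} → e < L → F (r + e) ≡ 0
    mid {e} e<L = trans (cong (λ b → f (r + e) * iverson b) (connects-mid (s≤s (m≤m+n r e)) (1+r+e<m e<L)))
                        (*-zeroʳ (f (r + e)))

  ∑-connects : ∀ (h : ℕ → ℕ) →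
    ∑[ d < n ] (h d * iverson (connects d)) ≡ ∑[ e < r ] (h (suc e) + h (n ∸ suc e)) + h m
  ∑-connects h = begin
    ∑ n F                                         ≡⟨ cong (λ l → ∑ l F) n≡m+m ⟩
    ∑ (m + m) F                                   ≡⟨ ∑-split m m F ⟩
    ∑ m F + ∑[ d < m ] F (m + d)
      ≡⟨ cong₂ _+_ (cong (λ l → ∑ l F) (sym (suc-pred m))) upper-half ⟩
    (F 0 + ∑ m′ (F ∘ suc)) + ∑ (suc m′) G         ≡⟨ cong (F 0 + ∑ m′ (F ∘ suc) +_) (∑-last m′ G) ⟩
    (F 0 + ∑ m′ (F ∘ suc)) + (∑ m′ G + G m′)
      ≡⟨ cong₂ (λ a b → (a + ∑ m′ (F ∘ suc)) + (∑ m′ G + b)) (*-zeroʳ (h 0)) G-last ⟩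
    ∑ m′ (F ∘ suc) + (∑ m′ G + h m)               ≡⟨ +-assoc (∑ m′ (F ∘ suc)) (∑ m′ G) (h m) ⟨
    ∑ m′ (F ∘ suc) + ∑ m′ G + h m                 ≡⟨ cong (_+ h m) (∑-distrib-+ m′ (F ∘ suc) G) ⟨
    ∑[ e < m′ ] (F (suc e) + G e) + h m
      ≡⟨ cong (_+ h m) (∑-cong m′ (λ {e} _ → *-distribʳ-+ (iverson (connects (suc e))) (h (suc e)) _)) ⟨
    ∑[ e < m′ ] ((h (suc e) + h (n ∸ suc e)) * iverson (connects (suc e))) + h m
      ≡⟨ cong (_+ h m) (lower-half (λ e → h (suc e) + h (n ∸ suc e))) ⟩
    ∑[ e < r ] (h (suc e) + h (n ∸ suc e)) + h m  ∎
    where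
    open ≡-Reasoning
    m′ = pred m
    F G : ℕ → ℕ
    F d = h d * iverson (connects d)
    G d = h (n ∸ suc d) * iverson (connects (suc d))
    upper-half : ∑[ d < m ] F (m + d) ≡ ∑ (suc m′) G
    upper-half = begin
      ∑[ d < m ] F (m + d)                 ≡⟨ ∑-reverse m (λ d → F (m + d)) ⟩
      ∑[ d < m ] F (m + (m ∸ suc d))       ≡⟨ ∑-cong m reflect ⟩
      ∑ m G                                ≡⟨ cong (λ l → ∑ l G) (sym (suc-pred m)) ⟩
      ∑ (suc m′) G                         ∎
      where
      reflect : ∀ {d} → d < m → F (m + (m ∸ suc d)) ≡ G d
      reflect {d} d<m rewrite sym (+-∸-assoc m d<m) | sym n≡m+m
                            | connects-sym (z<s {d}) (≤-<-trans d<m m<n) = refl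
    G-last : G m′ ≡ h m
    G-last = begin
      h (n ∸ suc m′) * iverson (connects (suc m′))
        ≡⟨ cong (λ l → h (n ∸ l) * iverson (connects l)) (suc-pred m) ⟩
      h (n ∸ m) * iverson (connects m)  ≡⟨ cong₂ (λ a b → h a * iverson b) n∸m≡m connects-half ⟩
      h m * 1                           ≡⟨ *-identityʳ (h m) ⟩
      h m                               ∎

  H : Multigraph n
  H = hararyMult k n

  H-loopless : ∀ v → H v v ≡ 0
  H-loopless v rewrite cdiff-self n (toℕ v) = refl

  H-inflow : ∀ (f : ℕ → ℕ) w → sumℕ (λ v → f (toℕ v) * H v w) ≡
    ∑[ e < r ] (f ((toℕ w + suc e) % n) + f ((toℕ w + (n ∸ suc e)) % n)) + f ((toℕ w + m) % n)
  H-inflow f w = begin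
    sumℕ (λ v → f (toℕ v) * H v w)
      ≡⟨ sumℕ-∑ n (λ i → f i * iverson (hararyAdj k n i x)) ⟩
    ∑[ i < n ] (f i * iverson (hararyAdj k n i x))
      ≡⟨ ∑-rotate n _ x<n ⟩
    ∑[ d < n ] (f ((x + d) % n) * iverson (hararyAdj k n ((x + d) % n) x))
      ≡⟨ ∑-cong n (λ {d} d<n → cong (λ b → f ((x + d) % n) * iverson b) (adjacent-in x<n d<n)) ⟩
    ∑[ d < n ] (f ((x + d) % n) * iverson (connects d))
      ≡⟨ ∑-connects (λ d → f ((x + d) % n)) ⟩
    ∑[ e < r ] (f ((x + suc e) % n) + f ((x + (n ∸ suc e)) % n)) + f ((x + m) % n)
      ∎
    where
    open ≡-Reasoning
    x = toℕ w
    x<n = Finₚ.toℕ<n w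

  H-regular : ∀ w → valence H w ≡ k
  H-regular w = begin
    sumℕ (λ v → H w v)                                ≡⟨ sumℕ-∑ n (λ i → iverson (hararyAdj k n x i)) ⟩
    ∑[ i < n ] iverson (hararyAdj k n x i)             ≡⟨ ∑-rotate n _ x<n ⟩
    ∑[ d < n ] iverson (hararyAdj k n x ((x + d) % n))
      ≡⟨ ∑-cong n (λ d<n → trans (cong iverson (adjacent-out x<n d<n)) (sym (*-identityˡ _))) ⟩
    ∑[ d < n ] (1 * iverson (connects d))              ≡⟨ ∑-connects (λ _ → 1) ⟩
    ∑[ e < r ] 2 + 1                                  ≡⟨ cong (_+ 1) (∑-const r 2) ⟩
    r * 2 + 1                                         ≡⟨ +-comm (r * 2) 1 ⟩
    k                                                 ∎
    where
    open ≡-Reasoning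
    x = toℕ w
    x<n = Finₚ.toℕ<n w

module GonalityWitness (r m : ℕ) (0<r : 0 < r) (r<m : r < m) where

  open HararyGraph r m r<m
  open NearestMultiple m

  g : ℕ → ℕ
  g t = (r ∸ t) * (suc r ∸ t)

  D : Fin n → ℕ
  D v = g ‖ toℕ v ‖

  script : ℕ → Fin n → ℕ
  script a v = a ∸ ‖ toℕ v ‖

  ‖‖-%n : ∀ i → ‖ i % n ‖ ≡ ‖ i ‖
  ‖‖-%n i = ‖‖-cong (m∣n⇒o%n%m≡o%m m n i (m∣m*n 2))

  ‖+n∸‖ : ∀ x {d} → d ≤ m → ‖ x + (n ∸ d) ‖ ≡ ‖ x + (m ∸ d) ‖
  ‖+n∸‖ x {d} d≤m = begin
    ‖ x + (n ∸ d) ‖            ≡⟨ cong (λ l → ‖ x + (l ∸ d) ‖) n≡m+m ⟩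
    ‖ x + (m + m ∸ d) ‖        ≡⟨ cong (λ l → ‖ x + l ‖) (trans (+-∸-assoc m d≤m) (+-comm m (m ∸ d))) ⟩
    ‖ x + ((m ∸ d) + m) ‖      ≡⟨ cong ‖_‖ (sym (+-assoc x (m ∸ d) m)) ⟩
    ‖ x + (m ∸ d) + m ‖        ≡⟨ cong (λ l → ‖ x + (m ∸ d) + l ‖) (sym (*-identityˡ m)) ⟩
    ‖ x + (m ∸ d) + 1 * m ‖    ≡⟨ ‖‖-periodic (x + (m ∸ d)) 1 ⟩
    ‖ x + (m ∸ d) ‖            ∎
    where open ≡-Reasoning

  inflow : ℕ → ℕ → ℕ
  inflow a x = ∑[ e < r ] ((a ∸ ‖ x + suc e ‖) + (a ∸ ‖ x + (m ∸ suc e) ‖)) + (a ∸ ‖ x ‖)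

  script-inflow : ∀ a w → sumℕ (λ v → script a v * H v w) ≡ inflow a (toℕ w)
  script-inflow a w = begin
    sumℕ (λ v → script a v * H v w)
      ≡⟨ H-inflow (λ i → a ∸ ‖ i ‖) w ⟩
    ∑[ e < r ] ((a ∸ ‖ (x + suc e) % n ‖) + (a ∸ ‖ (x + (n ∸ suc e)) % n ‖)) + (a ∸ ‖ (x + m) % n ‖)
      ≡⟨ cong₂ _+_ (∑-cong r λ e<r → cong₂ _+_ (cong (a ∸_) (‖‖-%n _)) (cong (a ∸_) (backward e<r)))
                   (cong (a ∸_) antipode) ⟩
    inflow a x
      ∎
    where
    open ≡-Reasoning
    x = toℕ w
    backward : ∀ {e} → e < r → ‖ (x + (n ∸ suc e)) % n ‖ ≡ ‖ x + (m ∸ suc e) ‖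
    backward e<r = trans (‖‖-%n _) (‖+n∸‖ x (<-trans e<r r<m))
    antipode : ‖ (x + m) % n ‖ ≡ ‖ x ‖
    antipode = trans (‖‖-%n (x + m)) (trans (cong ‖_‖ (cong (_+_ x) (sym (*-identityˡ m)))) (‖‖-periodic x 1))

  script-balanced : ∀ a w → script a w * k ≤ D w + inflow a (toℕ w)
  script-balanced a w = begin
    φ * k
      ≡⟨ solve 2 (λ r φ → φ :* (con 1 :+ r :* con 2) := r :* (con 2 :* φ) :+ φ) refl r φ ⟩
    r * (2 * φ) + φ                                   ≡⟨ cong (_+ φ) (∑-const r (2 * φ)) ⟨
    ∑[ e < r ] (2 * φ) + φ                            ≤⟨ +-monoˡ-≤ φ (∑-mono r pair) ⟩
    ∑[ e < r ] (P e + 2 * (suc e ∸ t)) + φ            ≡⟨ cong (_+ φ) (∑-distrib-+ r P (λ e → 2 * (suc e ∸ t))) ⟩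
    ∑ r P + ∑[ e < r ] (2 * (suc e ∸ t)) + φ          ≡⟨ cong (λ s → ∑ r P + s + φ) (∑-deficit r t) ⟩
    ∑ r P + g t + φ
      ≡⟨ solve 3 (λ p g φ → p :+ g :+ φ := g :+ (p :+ φ)) refl (∑ r P) (g t) φ ⟩
    g t + (∑ r P + φ)                                 ∎
    where
    open ≤-Reasoning
    open +-*-Solver
    x = toℕ w
    t = ‖ x ‖
    φ = a ∸ t
    P : ℕ → ℕ
    P e = (a ∸ ‖ x + suc e ‖) + (a ∸ ‖ x + (m ∸ suc e) ‖)
    pair : ∀ {e} → e < r → 2 * φ ≤ P e + 2 * (suc e ∸ t)
    pair {e} e<r = ∸-convex a {t} {suc e ∸ t} {‖ x + suc e ‖} {‖ x + (m ∸ suc e) ‖}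
                            (‖‖-midpoint x (<-trans e<r r<m))

  inflow-head : ∀ a x → (a ∸ ‖ x + 1 ‖) + (a ∸ ‖ x + (m ∸ 1) ‖) ≤ inflow a x
  inflow-head a x = ≤-trans (∑-head 0<r) (m≤m+n _ _)

  script-strict : ∀ x → 0 < g ‖ x ‖ + inflow ‖ x ‖ x
  script-strict x = strict ‖ x ‖ refl
    where
    strict : ∀ t → ‖ x ‖ ≡ t → 0 < g t + inflow t x
    strict zero    _  = ≤-trans (*-mono-≤ 0<r (s≤s z≤n)) (m≤m+n (g 0) _)
    strict (suc t) eq =
      <-≤-trans (head-positive (‖‖-descent x (subst (0 <_) (sym eq) z<s)))
                (≤-trans (inflow-head (suc t) x) (m≤n+m (inflow (suc t) x) (g (suc t))))
      where
      a = suc t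
      head-positive : ‖ x + 1 ‖ < ‖ x ‖ ⊎ ‖ x + (m ∸ 1) ‖ < ‖ x ‖ →
                      0 < (a ∸ ‖ x + 1 ‖) + (a ∸ ‖ x + (m ∸ 1) ‖)
      head-positive (inj₁ lt) =
        <-≤-trans (m<n⇒0<n∸m (subst (‖ x + 1 ‖ <_) eq lt)) (m≤m+n (a ∸ ‖ x + 1 ‖) _)
      head-positive (inj₂ lt) =
        <-≤-trans (m<n⇒0<n∸m (subst (‖ x + (m ∸ 1) ‖ <_) eq lt)) (m≤n+m (a ∸ ‖ x + (m ∸ 1) ‖) _)

  positiveRank : PositiveRank H (ℤ.+_ ∘ D)
  positiveRank = positiveRank-by-scripts D λ q →
      script ‖ toℕ q ‖
    , (λ w → subst₂ _≤_ (cong (script ‖ toℕ q ‖ w *_) (sym (H-regular w)))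
                        (cong (D w +_) (sym (script-inflow ‖ toℕ q ‖ w)))
                        (script-balanced ‖ toℕ q ‖ w))
    , subst₂ _<_ (cong (λ c → c * valence H q) (sym (n∸n≡0 ‖ toℕ q ‖)))
                 (cong (D q +_) (sym (script-inflow ‖ toℕ q ‖ q)))
                 (script-strict (toℕ q))
    where open ChipFiring H H-loopless

  g‖‖≤ : ∀ {i} → i < m → g ‖ i ‖ ≤ g i + g (m ∸ i)
  g‖‖≤ {i} i<m rewrite ‖‖-< i<m with ⊓-sel i (m ∸ i)
  ... | inj₁ t≡i   rewrite t≡i   = m≤m+n (g i) (g (m ∸ i))
  ... | inj₂ t≡m∸i rewrite t≡m∸i = m≤n+m (g (m ∸ i)) (g i)

  ∑g‖‖≤ : ∑[ i < m ] g ‖ i ‖ ≤ ∑ m g + ∑[ i < m ] g (suc i)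
  ∑g‖‖≤ = begin
    ∑[ i < m ] g ‖ i ‖                      ≤⟨ ∑-mono m g‖‖≤ ⟩
    ∑[ i < m ] (g i + g (m ∸ i))            ≡⟨ ∑-distrib-+ m g (λ i → g (m ∸ i)) ⟩
    ∑ m g + ∑[ i < m ] g (m ∸ i)            ≡⟨ cong (∑ m g +_) (∑-reverse m (λ i → g (m ∸ i))) ⟩
    ∑ m g + ∑[ i < m ] g (m ∸ (m ∸ suc i))  ≡⟨ cong (∑ m g +_) (∑-cong m (cong g ∘ m∸[m∸n]≡n)) ⟩
    ∑ m g + ∑[ i < m ] g (suc i)            ∎
    where open ≤-Reasoning

  degree-ℕ : 6 * sumℕ D ≤ (k ∸ 1) * k * (k + 1)
  degree-ℕ = begin
    6 * sumℕ D                   ≡⟨ cong (6 *_) (sumℕ-∑ n (λ i → g ‖ i ‖)) ⟩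
    6 * ∑[ i < n ] g ‖ i ‖        ≡⟨ cong (6 *_) halves ⟩
    6 * (S + S)                  ≤⟨ *-monoʳ-≤ 6 (+-mono-≤ ∑g‖‖≤ ∑g‖‖≤) ⟩
    6 * ((A + B) + (A + B))
      ≡⟨ solve 2 (λ a b → con 6 :* ((a :+ b) :+ (a :+ b)) := con 4 :* (con 3 :* a :+ con 3 :* b)) refl A B ⟩
    4 * (3 * A + 3 * B)
      ≡⟨ cong₂ (λ a b → 4 * (a + b)) (∑-pronic (suc r) m r<m) (∑-pronic r m (<⇒≤ r<m)) ⟩
    4 * (r * suc r * suc (suc r) + (r ∸ 1) * r * suc r)
      ≡⟨ closed-form r ⟩
    r * 2 * suc (r * 2) * (suc (r * 2) + 1)
      ∎
    where
    open ≤-Reasoning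
    open +-*-Solver
    S = ∑[ i < m ] g ‖ i ‖
    A = ∑ m g
    B = ∑[ i < m ] g (suc i)
    halves : ∑[ i < n ] g ‖ i ‖ ≡ S + S
    halves = trans (cong (λ l → ∑ l (λ i → g ‖ i ‖)) n≡m+m)
                   (trans (∑-split m m (λ i → g ‖ i ‖)) (cong (S +_) (∑-cong m (λ {i} _ → cong g (‖m+‖ i)))))
    closed-form : ∀ r → 4 * (r * suc r * suc (suc r) + (r ∸ 1) * r * suc r)
                        ≡ r * 2 * suc (r * 2) * (suc (r * 2) + 1)
    closed-form zero    = refl
    closed-form (suc r) =
      solve 1 (λ r → con 4 :* ((con 1 :+ r) :* (con 2 :+ r) :* (con 3 :+ r) :+ r :* (con 1 :+ r) :* (con 2 :+ r))
                  := (con 2 :+ r :* con 2) :* (con 3 :+ r :* con 2) :* (con 3 :+ r :* con 2 :+ con 1)) refl r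

  degree : ℤ.+ 6 ℤ.* deg (ℤ.+_ ∘ D) ℤ.≤ ℤ.+ ((k ∸ 1) * k * (k + 1))
  degree = subst (ℤ._≤ ℤ.+ ((k ∸ 1) * k * (k + 1)))
                 (trans (ℤₚ.pos-* 6 (sumℕ D)) (cong (ℤ.+ 6 ℤ.*_) (sym (sumℤ-pos D))))
                 (ℤ.+≤+ degree-ℕ)

corollary3p4 : (k n : ℕ) → Odd k → Even n → 3 ≤ k → k ≤ n ∸ 1 →
    GonAtMost (hararyMult k n) ((k ∸ 1) * k * (k + 1)) 6
corollary3p4 _ _ (r , refl) (zero   , refl) _ ()
corollary3p4 _ _ (r , refl) (suc m′ , refl) (s≤s 2≤2r) (s≤s 2r≤2m′) = ℤ.+_ ∘ D , positiveRank , degree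
  where open GonalityWitness r (suc m′) (*-cancelʳ-≤ 1 r 2 2≤2r) (s≤s (*-cancelʳ-≤ r m′ 2 2r≤2m′))
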